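{- Let $\pi=\pi_1\cdots\pi_n$ be a permutation with positive entries and let $t$ be a positive integer. Then $s^t(\pi)$ can be written as a concatenation $LR$, where $R$ is the increasing arrangement of the set $\bigcup_{i=1}^t\mathcal M_i(\pi)$, and the set of right-to-left maxima of $L$ is $\mathcal M_{t+1}(\pi)$.
   Context: A permutation is an ordering of a finite set of integers in one-line notation. The stack-sorting map $s$: $s$ of the empty permutation is empty, and if $\pi=LmR$ with $m$ the largest entry, then $s(\pi)=s(L)s(R)m$; $s^t$ is its $t$-fold iterate. A right-to-left maximum of $\tau=\tau_1\cdots\tau_k$ is an entry $\tau_i$ with $\tau_i>\tau_j$ for all $j>i$. An ordered set partition of a finite set $\mathcal E$ of positive integers is a tuple $\mathcal B=(B_1,\dots,B_r)$ of pairwise disjoint nonempty sets with union $\mathcal E$; it is in standard form if $\max B_1>\cdots>\max B_r$ (the empty tuple $()$ is an ordered set partition of $\emptyset$ in standard form). Let $\mathcal M(\mathcal B)=\{\max B_i:1\le i\le r\}$ (so $\mathcal M(())=\emptyset$). Define $\eta(\mathcal B)$ as follows: let $\widehat B_i=B_i\setminus\{\max B_i\}$. If all $\widehat B_i$ are empty, $\eta(\mathcal B)=()$. Otherwise, with the convention $\max\emptyset=-\infty$, let $J=\{j_1<\cdots<j_h\}$ be the set of indices $j$ such that $\max\widehat B_j>\max\widehat B_i$ for all $i\in\{j+1,\dots,r\}$; put $j_0=0$ and $B'_\ell=\bigcup_{j_{\ell-1}<i\le j_\ell}\widehat B_i$ for $1\le\ell\le h$; then $\eta(\mathcal B)$ is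 $(B'_1,\dots,B'_h)$ with all empty sets removed. For a permutation $\pi=\pi_1\cdots\pi_n$ with positive entries whose right-to-left maxima are in positions $i_1<\cdots<i_r$, set $i_0=0$, $\mathscr B_\ell(\pi)=\{\pi_i:i_{\ell-1}<i\le i_\ell\}$, $\mathcal B_1(\pi)=(\mathscr B_1(\pi),\dots,\mathscr B_r(\pi))$, and recursively $\mathcal B_\ell(\pi)=\eta(\mathcal B_{\ell-1}(\pi))$ for $\ell\ge2$; finally $\mathcal M_\ell(\pi)=\mathcal M(\mathcal B_\ell(\pi))$ for $\ell\ge1$. -}

module Defs where

open import Data.Nat using (ℕ; zero; suc; _⊔_; _<ᵇ_; _≡ᵇ_)
open import Data.Bool using (Bool; true; false; if_then_else_; _∨_; _∧_; not)
open import Data.List using (List; []; _∷_; _++_; [_]; length; map; filter; null; foldr)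
open import Data.Maybe using (Maybe; just; nothing)
open import Data.Product using (_×_; _,_; proj₁; proj₂)
open import Data.Bool using (T)
open import Relation.Nullary.Decidable using (T?)

-- Permutations are lists of (distinct, positive) naturals in one-line notation.
-- Finite sets / blocks are represented as lists (element order irrelevant).

-- maximum of a list (0 for the empty list; only applied to nonempty lists of positive entries)
maxL : List ℕ → ℕ
maxL = foldr _⊔_ 0

splitAtElem : ℕ → List ℕ → List ℕ × List ℕ
splitAtElem m [] = [] , []
splitAtElem m (x ∷ xs) with x ≡ᵇ m
... | true  = [] , xs
... | false = let (l , r) = splitAtElem m xs in (x ∷ l , r)

-- stack-sorting map with fuel: s(LmR) = s(L) s(R) m, m the largest entry
sFuel : ℕ → List ℕ → List ℕ
sFuel zero    _  = []
sFuel (suc k) [] = []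
sFuel (suc k) (x ∷ xs) =
  let m = maxL (x ∷ xs)
      (l , r) = splitAtElem m (x ∷ xs)
  in sFuel k l ++ sFuel k r ++ [ m ]

-- the stack-sorting map (fuel = length suffices, since |L|,|R| < |π|)
s : List ℕ → List ℕ
s π = sFuel (length π) π

sIter : ℕ → List ℕ → List ℕ
sIter zero    π = π
sIter (suc t) π = s (sIter t π)

allBelow : ℕ → List ℕ → Bool
allBelow x []       = true
allBelow x (y ∷ ys) = (y <ᵇ x) ∧ allBelow x ys

rlMaxima : List ℕ → List ℕ
rlMaxima []       = []
rlMaxima (x ∷ xs) = if allBelow x xs then x ∷ rlMaxima xs else rlMaxima xs

blocksGo : List ℕ → List ℕ → List (List ℕ)
blocksGo acc []       = []
blocksGo acc (x ∷ xs) =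
  if allBelow x xs then (acc ++ [ x ]) ∷ blocksGo [] xs else blocksGo (acc ++ [ x ]) xs

B₁ : List ℕ → List (List ℕ)
B₁ π = blocksGo [] π

-- max with the convention max ∅ = -∞ (nothing)
maxM : List ℕ → Maybe ℕ
maxM []       = nothing
maxM (x ∷ xs) = just (maxL (x ∷ xs))

gtM : Maybe ℕ → Maybe ℕ → Bool
gtM nothing  _        = false
gtM (just a) nothing  = true
gtM (just a) (just b) = b <ᵇ a

maxAll : List (List ℕ) → Maybe ℕ
maxAll hs = maxM (foldr _++_ [] hs)

removeMax : List ℕ → List ℕ
removeMax b = filter (λ x → T? (not (x ≡ᵇ maxL b))) b

-- group consecutive hats: close a group at index j iff j ∈ J, i.e.
-- max B̂_j > max B̂_i for all i > j (vacuous for j = r)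
groupGo : List ℕ → List (List ℕ) → List (List ℕ)
groupGo acc []       = []
groupGo acc (h ∷ hs) =
  if null hs ∨ gtM (maxM h) (maxAll hs)
  then (acc ++ h) ∷ groupGo [] hs
  else groupGo (acc ++ h) hs

nonEmpty : List ℕ → Bool
nonEmpty xs = not (null xs)

η : List (List ℕ) → List (List ℕ)
η bs = filter (λ b → T? (nonEmpty b)) (groupGo [] (map removeMax bs))

-- 𝓑_ℓ(π) for ℓ ≥ 1 (index 0 is unused and set to ())
𝓑 : ℕ → List ℕ → List (List ℕ)
𝓑 zero          π = []
𝓑 (suc zero)    π = B₁ π
𝓑 (suc (suc ℓ)) π = η (𝓑 (suc ℓ) π)

𝓜 : List (List ℕ) → List ℕ
𝓜 bs = map maxL bs

𝓜ₗ : ℕ → List ℕ → List ℕ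
𝓜ₗ ℓ π = 𝓜 (𝓑 ℓ π)

module Submission where

-- Everything rests on the recursive description of the operations on a max split
-- L = A ++ m ∷ B (all entries of A and B below m), and on induction along max splits.
-- With hats(L) the blocks of 𝓑₁(L) with their maxima removed, one application of s gives
--
--  * (one-pass lemma) for U increasing and disjoint from L:
--      s(L ++ U) = s(hat₁) ++ ⋯ ++ s(hatᵣ) ++ W,  W the increasing arrangement of rlMaxima(L) ∪ U;
--  * (block lemma) cutting s(hat₁) ++ ⋯ ++ s(hatᵣ) after its right-to-left maxima yields the
--      blocks of η(𝓑₁(L)), each up to rearrangement of its entries.
--
-- Since η, block maxima and right-to-left maxima are insensitive to rearranging entries
-- inside blocks, induction on t maintains: s^t(π) = L ++ R with R increasing with entries
-- 𝓜₁(π) ∪ ⋯ ∪ 𝓜ₜ(π), and 𝓑₁(L) equal to 𝓑ₜ₊₁(π) blockwise up to rearrangement. The theorem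
-- reads this invariant off; it does not need the entries to be positive nor t ≥ 1.

open import Defs
open import Data.Nat using (ℕ; suc; _<_; _≤_)
open import Data.List using (List; _++_)
open import Data.List.Relation.Unary.All using (All)
open import Data.List.Relation.Unary.Unique.Propositional using (Unique)
open import Data.List.Relation.Unary.Linked using (Linked)
open import Data.List.Membership.Propositional using (_∈_)
open import Data.Product using (Σ; ∃; _×_)
open import Relation.Binary.PropositionalEquality using (_≡_)
open import Function.Bundles using (_⇔_)

open import Data.Bool using (true; false; T; not; _∨_)
open import Data.Maybe using (just)
open import Data.Empty using (⊥; ⊥-elim)
open import Data.Nat using (zero; _<ᵇ_; _≡ᵇ_; z≤n; s≤s; z<s)
open import Data.Nat.Properties
open import Data.Nat.Induction using (<-wellFounded)
open import Data.List using ([]; _∷_; [_]; length; map; filter; concat; concatMap; null)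
open import Data.List.Properties using (++-assoc; ++-identityʳ; length-++; concat-++; concatMap-++; ++-monoid)
open import Data.List.Relation.Unary.All using ([]; _∷_)
import Data.List.Relation.Unary.All as All
import Data.List.Relation.Unary.All.Properties as All
open import Data.List.Relation.Unary.AllPairs using (AllPairs; []; _∷_)
import Data.List.Relation.Unary.AllPairs as AllPairs using (tail)
import Data.List.Relation.Unary.AllPairs.Properties as AllPairs
open import Data.List.Relation.Unary.Linked.Properties using (AllPairs⇒Linked)
open import Data.List.Relation.Unary.Any using (here; there)
open import Data.List.Relation.Binary.Disjoint.Propositional using (Disjoint)
open import Data.List.Relation.Binary.Pointwise as Pointwise using (Pointwise; []; _∷_)
open import Data.List.Relation.Binary.Permutation.Propositional
  using (_↭_; ↭-refl; ↭-reflexive; ↭-prep; ↭-sym; ↭-trans; ↭⇒↭ₛ; module PermutationReasoning)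
open import Data.List.Relation.Binary.Permutation.Propositional.Properties
  using (++⁺; ++⁺ˡ; ++⁺ʳ; ∷↭∷ʳ; shift; ↭-empty-inv; filter-↭; ∈-resp-↭; All-resp-↭)
import Data.List.Relation.Binary.Permutation.Setoid.Properties as PermutationSetoid
open import Data.List.Membership.Propositional using (_∉_)
open import Data.List.Membership.Propositional.Properties
  using (∈-++⁺ˡ; ∈-++⁺ʳ; ++-∈⇔; ∈-∃++; ∈-concat⁺′; ∈-concat⁻′)
open import Data.List.Relation.Unary.Unique.Propositional.Properties using (Unique[x∷xs]⇒x∉xs)
open import Data.Product using (∃₂; _,_; proj₁; proj₂)
open import Data.Sum using (_⊎_; inj₁; inj₂)
open import Function using (_∘_; case_of_)
open import Function.Bundles using (mk⇔)
open import Function.Properties.Equivalence using () renaming (refl to ⇔-refl; trans to ⇔-trans)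
open import Data.Sum.Function.Propositional using (_⊎-⇔_)
import Induction.WellFounded as WellFounded
open import Relation.Binary.Construct.On as On using ()
open import Relation.Binary.Definitions using (tri<; tri≈; tri>)
open import Relation.Binary.PropositionalEquality
  using (refl; sym; trans; cong; cong₂; subst; subst₂; setoid; _≢_; module ≡-Reasoning)
open import Relation.Nullary.Decidable using (T?)
open import Algebra.Solver.Monoid (++-monoid ℕ) using (solve; _⊕_; _⊜_)

module PermutationSetoidℕ = PermutationSetoid (setoid ℕ)

length-ind : ∀ {a ℓ} {A : Set a} (P : List A → Set ℓ) →
  (∀ xs → (∀ {ys} → length ys < length xs → P ys) → P xs) → ∀ xs → P xs
length-ind {ℓ = ℓ} P = WellFounded.All.wfRec (On.wellFounded length <-wellFounded) ℓ P

parts-shorter : ∀ {a} {A : Set a} (xs : List A) y zs →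
  length xs < length (xs ++ y ∷ zs) × length zs < length (xs ++ y ∷ zs)
parts-shorter xs y zs rewrite length-++ xs {y ∷ zs} =
  m<m+n (length xs) z<s , m≤n+m (suc (length zs)) (length xs)

AllPairs-++⁻ : ∀ {a ℓ} {A : Set a} {R : A → A → Set ℓ} xs {ys} → AllPairs R (xs ++ ys) →
  AllPairs R xs × AllPairs R ys × All (λ x → All (R x) ys) xs
AllPairs-++⁻ [] rs = [] , rs , []
AllPairs-++⁻ (x ∷ xs) (rx ∷ rs) with AllPairs-++⁻ xs rs
... | rxs , rys , rxys = All.++⁻ˡ xs rx ∷ rxs , rys , All.++⁻ʳ xs rx ∷ rxys

unique-++ : ∀ (xs : List ℕ) {ys} → Unique (xs ++ ys) → Unique xs × Unique ys × Disjoint xs ys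
unique-++ xs u with AllPairs-++⁻ xs u
... | uxs , uys , apart = uxs , uys , λ (v∈xs , v∈ys) → All.lookup (All.lookup apart v∈xs) v∈ys refl

unique-↭ : ∀ {xs ys : List ℕ} → xs ↭ ys → Unique xs → Unique ys
unique-↭ p = PermutationSetoidℕ.Unique-resp-↭ (↭⇒↭ₛ p)

maxL-↭ : ∀ {xs ys} → xs ↭ ys → maxL xs ≡ maxL ys
maxL-↭ p = PermutationSetoidℕ.foldr-commMonoid ⊔-0-isCommutativeMonoid (↭⇒↭ₛ p)

maxL-bounds : ∀ xs → All (_≤ maxL xs) xs
maxL-bounds [] = []
maxL-bounds (x ∷ xs) =
  m≤m⊔n x (maxL xs) ∷ All.map (λ y≤ → ≤-trans y≤ (m≤n⊔m x (maxL xs))) (maxL-bounds xs)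

maxL-least : ∀ {k} xs → All (_≤ k) xs → maxL xs ≤ k
maxL-least [] [] = z≤n
maxL-least (x ∷ xs) (x≤k ∷ xs≤k) = ⊔-lub x≤k (maxL-least xs xs≤k)

maxL-∈ : ∀ x xs → maxL (x ∷ xs) ∈ x ∷ xs
maxL-∈ x [] rewrite ⊔-identityʳ x = here refl
maxL-∈ x (y ∷ ys) with ⊔-sel x (maxL (y ∷ ys))
... | inj₁ e rewrite e = here refl
... | inj₂ e rewrite e = there (maxL-∈ y ys)

maxL-split : ∀ {m} A B → All (_< m) A → All (_< m) B → maxL (A ++ m ∷ B) ≡ m
maxL-split A B A<m B<m =
  ≤-antisym (maxL-least _ (All.++⁺ (All.map <⇒≤ A<m) (≤-refl ∷ All.map <⇒≤ B<m)))
            (All.lookup (maxL-bounds (A ++ _ ∷ B)) (∈-++⁺ʳ A (here refl)))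

strictly-below : ∀ {m} A B → Unique (A ++ m ∷ B) → All (_≤ m) (A ++ m ∷ B) →
  All (_< m) A × All (_< m) B
strictly-below {m} A B u bounded with unique-++ A u
... | _ , u-mB , disjoint =
  strict (All.++⁻ˡ A bounded) (λ m∈A → disjoint (m∈A , here refl)) ,
  strict (All.tail (All.++⁻ʳ A bounded)) (Unique[x∷xs]⇒x∉xs u-mB)
  where
  strict : ∀ {xs} → All (_≤ m) xs → m ∉ xs → All (_< m) xs
  strict [] _ = []
  strict (x≤m ∷ xs≤m) m∉ = ≤∧≢⇒< x≤m (λ x≡m → m∉ (here (sym x≡m))) ∷ strict xs≤m (m∉ ∘ there)

maxSplit-ind : ∀ {ℓ} (P : List ℕ → Set ℓ) → P [] →
  (∀ A m B → All (_< m) A → All (_< m) B → P A → P B → P (A ++ m ∷ B)) →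
  ∀ L → Unique L → P L
maxSplit-ind P base step = length-ind (λ L → Unique L → P L) go
  where
  go : ∀ L → (∀ {L′} → length L′ < length L → Unique L′ → P L′) → Unique L → P L
  go [] _ _ = base
  go L@(x ∷ xs) ih u with ∈-∃++ (maxL-∈ x xs)
  ... | A , B , L≡ = subst P (sym L≡) (step A m B A<m B<m (ih |A|< uA) (ih |B|< uB))
    where
    m = maxL L
    u′ : Unique (A ++ m ∷ B)
    u′ = subst Unique L≡ u
    below = strictly-below A B u′ (subst (All (_≤ m)) L≡ (maxL-bounds L))
    A<m = proj₁ below
    B<m = proj₂ below
    uA = proj₁ (unique-++ A u′)
    uB = AllPairs.tail (proj₁ (proj₂ (unique-++ A u′)))
    lengths = subst (λ σ → length A < length σ × length B < length σ) (sym L≡) (parts-shorter A m B)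
    |A|< = proj₁ lengths
    |B|< = proj₂ lengths

≡ᵇ-refl : ∀ a → (a ≡ᵇ a) ≡ true
≡ᵇ-refl a with a ≡ᵇ a | ≡⇒≡ᵇ a a refl
... | true | _ = refl

≡ᵇ-false : ∀ {a b} → a ≢ b → (a ≡ᵇ b) ≡ false
≡ᵇ-false {a} {b} a≢b with a ≡ᵇ b in eq
... | false = refl
... | true  = ⊥-elim (a≢b (≡ᵇ⇒≡ a b (subst T (sym eq) _)))

<ᵇ-true : ∀ {a b} → a < b → (a <ᵇ b) ≡ true
<ᵇ-true {a} {b} a<b with a <ᵇ b | <⇒<ᵇ a<b
... | true | _ = refl

<ᵇ-false : ∀ {a b} → b ≤ a → (a <ᵇ b) ≡ false
<ᵇ-false {a} {b} b≤a with a <ᵇ b in eq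
... | false = refl
... | true  = ⊥-elim (<⇒≱ (<ᵇ⇒< a b (subst T (sym eq) _)) b≤a)

allBelow-true : ∀ {x xs} → All (_< x) xs → allBelow x xs ≡ true
allBelow-true [] = refl
allBelow-true (y<x ∷ ys<x) rewrite <ᵇ-true y<x = allBelow-true ys<x

allBelow-false : ∀ {x y xs} → y ∈ xs → x < y → allBelow x xs ≡ false
allBelow-false {x} {y} (here refl) x<y rewrite <ᵇ-false {y} {x} (<⇒≤ x<y) = refl
allBelow-false {x} {xs = z ∷ _} (there y∈) x<y with z <ᵇ x
... | true  = allBelow-false y∈ x<y
... | false = refl

-- The definitions evaluated on a max split A ++ m ∷ B: the first occurrence of m is found after
-- A; m is a right-to-left maximum, while no entry of A is (m follows it); so 𝓑₁ cuts right
-- after m, and removing the maximum of the first block A ++ [ m ] leaves A.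
module _ {m : ℕ} where

  splitAtElem-max : ∀ A B → All (_< m) A → splitAtElem m (A ++ m ∷ B) ≡ (A , B)
  splitAtElem-max [] B [] rewrite ≡ᵇ-refl m = refl
  splitAtElem-max (a ∷ A) B (a<m ∷ A<m)
    rewrite ≡ᵇ-false (<⇒≢ a<m) | splitAtElem-max A B A<m = refl

  blocksGo-max : ∀ acc A B → All (_< m) A → All (_< m) B →
    blocksGo acc (A ++ m ∷ B) ≡ (acc ++ A ++ [ m ]) ∷ blocksGo [] B
  blocksGo-max acc [] B [] B<m rewrite allBelow-true B<m = refl
  blocksGo-max acc (a ∷ A) B (a<m ∷ A<m) B<m
    rewrite allBelow-false {a} {m} {A ++ m ∷ B} (∈-++⁺ʳ A (here refl)) a<m
          | blocksGo-max (acc ++ [ a ]) A B A<m B<m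
          | ++-assoc acc [ a ] (A ++ [ m ]) = refl

  B₁-max : ∀ A B → All (_< m) A → All (_< m) B → B₁ (A ++ m ∷ B) ≡ (A ++ [ m ]) ∷ B₁ B
  B₁-max = blocksGo-max []

  rlMaxima-max : ∀ A B → All (_< m) A → All (_< m) B → rlMaxima (A ++ m ∷ B) ≡ m ∷ rlMaxima B
  rlMaxima-max [] B [] B<m rewrite allBelow-true B<m = refl
  rlMaxima-max (a ∷ A) B (a<m ∷ A<m) B<m
    rewrite allBelow-false {a} {m} {A ++ m ∷ B} (∈-++⁺ʳ A (here refl)) a<m = rlMaxima-max A B A<m B<m

  removeMax-max : ∀ A → All (_< m) A → removeMax (A ++ [ m ]) ≡ A
  removeMax-max A A<m rewrite maxL-split A [] A<m [] = drop-m A A<m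
    where
    drop-m : ∀ A → All (_< m) A → filter (λ x → T? (not (x ≡ᵇ m))) (A ++ [ m ]) ≡ A
    drop-m [] [] rewrite ≡ᵇ-refl m = refl
    drop-m (a ∷ A) (a<m ∷ A<m) rewrite ≡ᵇ-false (<⇒≢ a<m) = cong (a ∷_) (drop-m A A<m)

split-reassemble : ∀ {m} τ → m ∈ τ →
  proj₁ (splitAtElem m τ) ++ m ∷ proj₂ (splitAtElem m τ) ≡ τ
split-reassemble {m} (x ∷ xs) m∈ with x ≡ᵇ m in eq
... | true = cong (_∷ xs) (sym (≡ᵇ⇒≡ x m (subst T (sym eq) _)))
... | false with m∈
...   | here refl  = case trans (sym eq) (≡ᵇ-refl x) of λ ()
...   | there m∈xs = cong (x ∷_) (split-reassemble xs m∈xs)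

split-fits : ∀ {m k} τ → m ∈ τ → length τ ≤ suc k →
  length (proj₁ (splitAtElem m τ)) ≤ k × length (proj₂ (splitAtElem m τ)) ≤ k
split-fits {m} {k} τ m∈ |τ|≤ = fits (proj₁ shorter) , fits (proj₂ shorter)
  where
  l = proj₁ (splitAtElem m τ)
  r = proj₂ (splitAtElem m τ)
  shorter = subst (λ σ → length l < length σ × length r < length σ) (split-reassemble τ m∈) (parts-shorter l m r)
  fits : ∀ {n} → n < length τ → n ≤ k
  fits n< = ≤-pred (≤-trans n< |τ|≤)

sFuel-nil : ∀ k → sFuel k [] ≡ []
sFuel-nil zero = refl
sFuel-nil (suc k) = refl

sFuel-stable : ∀ k k′ τ → length τ ≤ k → length τ ≤ k′ → sFuel k τ ≡ sFuel k′ τ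
sFuel-stable k k′ [] _ _ = trans (sFuel-nil k) (sym (sFuel-nil k′))
sFuel-stable (suc k) (suc k′) τ@(x ∷ xs) |τ|≤k |τ|≤k′ =
  cong₂ _++_ (sFuel-stable k k′ _ (proj₁ fit) (proj₁ fit′))
             (cong (_++ [ maxL τ ]) (sFuel-stable k k′ _ (proj₂ fit) (proj₂ fit′)))
  where
  fit  = split-fits τ (maxL-∈ x xs) |τ|≤k
  fit′ = split-fits τ (maxL-∈ x xs) |τ|≤k′

s-step : ∀ {y} τ → y ∈ τ →
  s τ ≡ s (proj₁ (splitAtElem (maxL τ) τ)) ++ s (proj₂ (splitAtElem (maxL τ) τ)) ++ [ maxL τ ]
s-step τ@(x ∷ xs) _ =
  cong₂ _++_ (sFuel-stable _ _ _ (proj₁ fit) ≤-refl)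
             (cong (_++ [ maxL τ ]) (sFuel-stable _ _ _ (proj₂ fit) ≤-refl))
  where fit = split-fits τ (maxL-∈ x xs) ≤-refl

s-max : ∀ {m} A B → All (_< m) A → All (_< m) B → s (A ++ m ∷ B) ≡ s A ++ s B ++ [ m ]
s-max {m} A B A<m B<m with s-step (A ++ m ∷ B) (∈-++⁺ʳ A (here refl))
... | unfolded rewrite maxL-split A B A<m B<m | splitAtElem-max A B A<m = unfolded

sFuel-↭ : ∀ k τ → length τ ≤ k → sFuel k τ ↭ τ
sFuel-↭ zero [] _ = ↭-refl
sFuel-↭ (suc k) [] _ = ↭-refl
sFuel-↭ (suc k) τ@(x ∷ xs) |τ|≤ = begin
  sFuel k l ++ sFuel k r ++ [ m ] ↭⟨ ++⁺ (sFuel-↭ k l (proj₁ fit)) (++⁺ʳ [ m ] (sFuel-↭ k r (proj₂ fit))) ⟩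
  l ++ r ++ [ m ]                 ↭⟨ ++⁺ˡ l (∷↭∷ʳ m r) ⟨
  l ++ m ∷ r                      ≡⟨ split-reassemble τ (maxL-∈ x xs) ⟩
  τ                               ∎
  where
  open PermutationReasoning
  m = maxL τ
  l = proj₁ (splitAtElem m τ)
  r = proj₂ (splitAtElem m τ)
  fit = split-fits τ (maxL-∈ x xs) |τ|≤

s-↭ : ∀ τ → s τ ↭ τ
s-↭ τ = sFuel-↭ (length τ) τ ≤-refl

sIter-↭ : ∀ t π → sIter t π ↭ π
sIter-↭ zero π = ↭-refl
sIter-↭ (suc t) π = ↭-trans (s-↭ (sIter t π)) (sIter-↭ t π)

s-++-increasing : ∀ P V → AllPairs _<_ V → All (λ p → All (p <_) V) P → s (P ++ V) ≡ s P ++ V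
s-++-increasing P [] _ _ = trans (cong s (++-identityʳ P)) (sym (++-identityʳ (s P)))
s-++-increasing P (v ∷ V) (v<V ∷ V↑) P<vV = begin
  s (P ++ v ∷ V)       ≡⟨ cong s (++-assoc P [ v ] V) ⟨
  s ((P ++ [ v ]) ++ V) ≡⟨ s-++-increasing (P ++ [ v ]) V V↑ (All.++⁺ (All.map All.tail P<vV) (v<V ∷ [])) ⟩
  s (P ++ [ v ]) ++ V   ≡⟨ cong (_++ V) (s-max P [] (All.map All.head P<vV) []) ⟩
  (s P ++ [ v ]) ++ V   ≡⟨ ++-assoc (s P) [ v ] V ⟩
  s P ++ v ∷ V          ∎
  where open ≡-Reasoning

hats : List ℕ → List (List ℕ)
hats L = map removeMax (B₁ L)

hats-max : ∀ {m} A B → All (_< m) A → All (_< m) B → hats (A ++ m ∷ B) ≡ A ∷ hats B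
hats-max A B A<m B<m rewrite B₁-max A B A<m B<m | removeMax-max A A<m = refl

rlMaxima-All : ∀ {P : ℕ → Set} L → All P L → All P (rlMaxima L)
rlMaxima-All [] [] = []
rlMaxima-All (x ∷ xs) (px ∷ pxs) with allBelow x xs
... | true  = px ∷ rlMaxima-All xs pxs
... | false = rlMaxima-All xs pxs

split-around : ∀ m U → AllPairs _<_ U → m ∉ U →
  ∃₂ λ U₁ U₂ → U ≡ U₁ ++ U₂ × All (_< m) U₁ × All (m <_) U₂
split-around m [] _ _ = [] , [] , refl , [] , []
split-around m (u ∷ U) (u<U ∷ U↑) m∉ with <-cmp u m
... | tri< u<m _ _ with split-around m U U↑ (m∉ ∘ there)
...   | U₁ , U₂ , refl , U₁<m , m<U₂ = u ∷ U₁ , U₂ , refl , u<m ∷ U₁<m , m<U₂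
split-around m (u ∷ U) _ m∉ | tri≈ _ u≡m _ = ⊥-elim (m∉ (here (sym u≡m)))
split-around m (u ∷ U) (u<U ∷ _) _ | tri> _ _ m<u = [] , u ∷ U , refl , [] , m<u ∷ All.map (<-trans m<u) u<U

record OnePass (L U : List ℕ) : Set where
  field
    W          : List ℕ
    s-split    : s (L ++ U) ≡ concatMap s (hats L) ++ W
    increasing : AllPairs _<_ W
    entries    : W ↭ rlMaxima L ++ U

s-around-max : ∀ A m B U₁ U₂ → All (_< m) A → All (_< m) B → All (_< m) U₁ → All (m <_) U₂ →
  AllPairs _<_ U₂ → s ((A ++ m ∷ B) ++ U₁ ++ U₂) ≡ s A ++ s (B ++ U₁) ++ m ∷ U₂
s-around-max A m B U₁ U₂ A<m B<m U₁<m m<U₂ U₂↑ = begin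
  s ((A ++ m ∷ B) ++ U₁ ++ U₂)
    ≡⟨ cong s (solve 5 (λ a mm b c d → (a ⊕ mm ⊕ b) ⊕ c ⊕ d ⊜ (a ⊕ mm ⊕ b ⊕ c) ⊕ d)
                      refl A [ m ] B U₁ U₂) ⟩
  s ((A ++ m ∷ (B ++ U₁)) ++ U₂)
    ≡⟨ s-++-increasing _ U₂ U₂↑ (All.map (λ p≤m → All.map (≤-<-trans p≤m) m<U₂) P≤m) ⟩
  s (A ++ m ∷ (B ++ U₁)) ++ U₂
    ≡⟨ cong (_++ U₂) (s-max A (B ++ U₁) A<m (All.++⁺ B<m U₁<m)) ⟩
  (s A ++ s (B ++ U₁) ++ [ m ]) ++ U₂
    ≡⟨ solve 4 (λ a b mm d → (a ⊕ b ⊕ mm) ⊕ d ⊜ a ⊕ b ⊕ mm ⊕ d) refl (s A) (s (B ++ U₁)) [ m ] U₂ ⟩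
  s A ++ s (B ++ U₁) ++ m ∷ U₂ ∎
  where
  open ≡-Reasoning
  P≤m : All (_≤ m) (A ++ m ∷ (B ++ U₁))
  P≤m = All.++⁺ (All.map <⇒≤ A<m) (≤-refl ∷ All.map <⇒≤ (All.++⁺ B<m U₁<m))

-- One-pass lemma, by induction along max splits of L: the entries of U below the maximum m
-- of L take part in sorting the part of L after m, those above m stay in place.
one-pass : ∀ L → Unique L → ∀ U → AllPairs _<_ U → Disjoint L U → OnePass L U
one-pass = maxSplit-ind Motive base step
  where
  Motive : List ℕ → Set
  Motive L = ∀ U → AllPairs _<_ U → Disjoint L U → OnePass L U

  base : Motive []
  base U U↑ _ = record { W = U ; s-split = s-++-increasing [] U U↑ [] ; increasing = U↑ ; entries = ↭-refl }

  step : ∀ A m B → All (_< m) A → All (_< m) B → Motive A → Motive B → Motive (A ++ m ∷ B)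
  step A m B A<m B<m _ ih U U↑ disjoint
    with split-around m U U↑ (λ m∈U → disjoint (∈-++⁺ʳ A (here refl) , m∈U))
  ... | U₁ , U₂ , refl , U₁<m , m<U₂ = record
    { W = W ++ m ∷ U₂ ; s-split = s-split′ ; increasing = increasing′ ; entries = entries′ }
    where
    U₁↑ = proj₁ (AllPairs-++⁻ U₁ U↑)
    U₂↑ = proj₁ (proj₂ (AllPairs-++⁻ U₁ U↑))
    open OnePass (ih U₁ U₁↑ (λ (x∈B , x∈U₁) → disjoint (∈-++⁺ʳ A (there x∈B) , ∈-++⁺ˡ x∈U₁)))
    s-split′ : s ((A ++ m ∷ B) ++ U₁ ++ U₂) ≡ concatMap s (hats (A ++ m ∷ B)) ++ W ++ m ∷ U₂
    s-split′ = begin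
      s ((A ++ m ∷ B) ++ U₁ ++ U₂)                   ≡⟨ s-around-max A m B U₁ U₂ A<m B<m U₁<m m<U₂ U₂↑ ⟩
      s A ++ s (B ++ U₁) ++ m ∷ U₂                   ≡⟨ cong (λ z → s A ++ z ++ m ∷ U₂) s-split ⟩
      s A ++ (concatMap s (hats B) ++ W) ++ m ∷ U₂
        ≡⟨ solve 4 (λ a x w r → a ⊕ (x ⊕ w) ⊕ r ⊜ (a ⊕ x) ⊕ w ⊕ r)
                 refl (s A) (concatMap s (hats B)) W (m ∷ U₂) ⟩
      (s A ++ concatMap s (hats B)) ++ W ++ m ∷ U₂
        ≡⟨ cong (λ hs → concatMap s hs ++ W ++ m ∷ U₂) (hats-max A B A<m B<m) ⟨
      concatMap s (hats (A ++ m ∷ B)) ++ W ++ m ∷ U₂ ∎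
      where open ≡-Reasoning
    W<m : All (_< m) W
    W<m = All-resp-↭ (↭-sym entries) (All.++⁺ (rlMaxima-All B B<m) U₁<m)
    increasing′ : AllPairs _<_ (W ++ m ∷ U₂)
    increasing′ = AllPairs.++⁺ increasing (m<U₂ ∷ U₂↑) (All.map (λ w<m → w<m ∷ All.map (<-trans w<m) m<U₂) W<m)
    entries′ : W ++ m ∷ U₂ ↭ rlMaxima (A ++ m ∷ B) ++ U₁ ++ U₂
    entries′ = begin
      W ++ m ∷ U₂                       ↭⟨ shift m W U₂ ⟩
      m ∷ W ++ U₂                       ↭⟨ ↭-prep m (++⁺ʳ U₂ entries) ⟩
      m ∷ (rlMaxima B ++ U₁) ++ U₂      ≡⟨ cong (m ∷_) (++-assoc (rlMaxima B) U₁ U₂) ⟩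
      m ∷ rlMaxima B ++ U₁ ++ U₂        ≡⟨ cong (_++ U₁ ++ U₂) (rlMaxima-max A B A<m B<m) ⟨
      rlMaxima (A ++ m ∷ B) ++ U₁ ++ U₂ ∎
      where open PermutationReasoning

-- η only inspects emptiness and maxima of blocks, which are insensitive to rearrangement;
-- hence η respects blockwise rearrangement (η-↭ below).
null-↭ : ∀ {xs ys : List ℕ} → xs ↭ ys → null xs ≡ null ys
null-↭ {[]} {[]} _ = refl
null-↭ {_ ∷ _} {_ ∷ _} _ = refl
null-↭ {[]} {_ ∷ _} p = case ↭-empty-inv (↭-sym p) of λ ()
null-↭ {_ ∷ _} {[]} p = case ↭-empty-inv p of λ ()

maxM-↭ : ∀ {xs ys} → xs ↭ ys → maxM xs ≡ maxM ys
maxM-↭ {[]} {[]} _ = refl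
maxM-↭ {_ ∷ _} {_ ∷ _} p = cong just (maxL-↭ p)
maxM-↭ {[]} {_ ∷ _} p = case ↭-empty-inv (↭-sym p) of λ ()
maxM-↭ {_ ∷ _} {[]} p = case ↭-empty-inv p of λ ()

removeMax-↭ : ∀ {xs ys} → xs ↭ ys → removeMax xs ↭ removeMax ys
removeMax-↭ p rewrite maxL-↭ p = filter-↭ _ p

concat-↭ : ∀ {xss yss : List (List ℕ)} → Pointwise _↭_ xss yss → concat xss ↭ concat yss
concat-↭ = Pointwise.foldr⁺ ++⁺ ↭-refl

null-Pointwise : ∀ {xss yss : List (List ℕ)} → Pointwise _↭_ xss yss → null xss ≡ null yss
null-Pointwise [] = refl
null-Pointwise (_ ∷ _) = refl

groupGo-↭ : ∀ {acc acc′ hs hs′} → acc ↭ acc′ → Pointwise _↭_ hs hs′ →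
  Pointwise _↭_ (groupGo acc hs) (groupGo acc′ hs′)
groupGo-↭ _ [] = []
groupGo-↭ {hs = h ∷ hs} {h′ ∷ hs′} acc↭ (h↭ ∷ hs↭)
  rewrite null-Pointwise hs↭ | maxM-↭ h↭ | maxM-↭ (concat-↭ hs↭)
  with null hs′ ∨ gtM (maxM h′) (maxAll hs′)
... | true  = ++⁺ acc↭ h↭ ∷ groupGo-↭ ↭-refl hs↭
... | false = groupGo-↭ (++⁺ acc↭ h↭) hs↭

dropEmpty : List (List ℕ) → List (List ℕ)
dropEmpty = filter (λ b → T? (nonEmpty b))

dropEmpty-↭ : ∀ {bs cs} → Pointwise _↭_ bs cs → Pointwise _↭_ (dropEmpty bs) (dropEmpty cs)
dropEmpty-↭ = Pointwise.filter⁺ _ _ (λ p → subst (T ∘ not) (null-↭ p)) (λ p → subst (T ∘ not) (sym (null-↭ p)))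

η-↭ : ∀ {bs cs} → Pointwise _↭_ bs cs → Pointwise _↭_ (η bs) (η cs)
η-↭ bs↭cs = dropEmpty-↭ (groupGo-↭ ↭-refl (Pointwise.map⁺ removeMax removeMax (Pointwise.map removeMax-↭ bs↭cs)))

maxM-nonempty : ∀ {x} zs → x ∈ zs → maxM zs ≡ just (maxL zs)
maxM-nonempty (_ ∷ _) _ = refl

closes-group : ∀ {m} h hs → m ∈ h → All (_< m) (concat hs) →
  (null hs ∨ gtM (maxM h) (maxAll hs)) ≡ true
closes-group h [] _ _ = refl
closes-group {m} h hs@(_ ∷ _) m∈h hs<m rewrite maxM-nonempty h m∈h with concat hs
... | []     = refl
... | z ∷ zs = <ᵇ-true (<-≤-trans (All.lookup hs<m (maxL-∈ z zs)) (All.lookup (maxL-bounds h) m∈h))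

continues-group : ∀ {m} h hs → All (_< m) h → m ∈ concat hs →
  (null hs ∨ gtM (maxM h) (maxAll hs)) ≡ false
continues-group _ [] _ ()
continues-group [] (_ ∷ _) _ _ = refl
continues-group {m} h@(c ∷ h′) hs@(_ ∷ _) h<m m∈hs rewrite maxM-nonempty (concat hs) m∈hs =
  <ᵇ-false (<⇒≤ (<-≤-trans (All.lookup h<m (maxL-∈ c h′)) (All.lookup (maxL-bounds (concat hs)) m∈hs)))

groupGo-at-max : ∀ {m} acc pre A post → All (_< m) (concat pre) → m ∈ A → All (_< m) (concat post) →
  groupGo acc (pre ++ A ∷ post) ≡ (acc ++ concat pre ++ A) ∷ groupGo [] post
groupGo-at-max acc [] A post _ m∈A post<m rewrite closes-group A post m∈A post<m = refl
groupGo-at-max {m} acc (h ∷ pre) A post h++pre<m m∈A post<m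
  rewrite continues-group h (pre ++ A ∷ post) (All.++⁻ˡ h h++pre<m) (∈-concat⁺′ m∈A (∈-++⁺ʳ pre (here refl)))
        | groupGo-at-max (acc ++ h) pre A post (All.++⁻ʳ h h++pre<m) m∈A post<m
        | ++-assoc acc h (concat pre ++ A)
        | ++-assoc h (concat pre) A = refl

groupGo-empty : ∀ hs → concat hs ≡ [] → dropEmpty (groupGo [] hs) ≡ []
groupGo-empty [] _ = refl
groupGo-empty ([] ∷ []) _ = refl
groupGo-empty ([] ∷ hs@(_ ∷ _)) e = groupGo-empty hs e

concatMap-s-empty : ∀ hs → concat hs ≡ [] → concatMap s hs ≡ []
concatMap-s-empty [] _ = refl
concatMap-s-empty ([] ∷ hs) e = concatMap-s-empty hs e

dropEmpty-∷ : ∀ {x} b bs → x ∈ b → dropEmpty (b ∷ bs) ≡ b ∷ dropEmpty bs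
dropEmpty-∷ (_ ∷ _) _ _ = refl

concatMap-s-↭ : ∀ hs → concatMap s hs ↭ concat hs
concatMap-s-↭ [] = ↭-refl
concatMap-s-↭ (h ∷ hs) = ++⁺ (s-↭ h) (concatMap-s-↭ hs)

concat-around : ∀ pre A₁ (m : ℕ) A₂ post →
  concat (pre ++ (A₁ ++ m ∷ A₂) ∷ post) ≡ (concat pre ++ A₁) ++ m ∷ (A₂ ++ concat post)
concat-around pre A₁ m A₂ post = begin
  concat (pre ++ (A₁ ++ m ∷ A₂) ∷ post)       ≡⟨ concat-++ pre _ ⟨
  concat pre ++ (A₁ ++ m ∷ A₂) ++ concat post
    ≡⟨ solve 5 (λ p a mm b q → p ⊕ (a ⊕ mm ⊕ b) ⊕ q ⊜ (p ⊕ a) ⊕ mm ⊕ b ⊕ q)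
               refl (concat pre) A₁ [ m ] A₂ (concat post) ⟩
  (concat pre ++ A₁) ++ m ∷ (A₂ ++ concat post) ∎
  where open ≡-Reasoning

blocks-at-max : ∀ pre A₁ m A₂ post →
  All (_< m) (concat pre) → All (_< m) A₁ → All (_< m) A₂ → All (_< m) (concat post) →
  Pointwise _↭_ (B₁ (concatMap s post)) (dropEmpty (groupGo [] post)) →
  Pointwise _↭_ (B₁ (concatMap s (pre ++ (A₁ ++ m ∷ A₂) ∷ post)))
                (dropEmpty (groupGo [] (pre ++ (A₁ ++ m ∷ A₂) ∷ post)))
blocks-at-max pre A₁ m A₂ post pre<m A₁<m A₂<m post<m ih =
  subst₂ (Pointwise _↭_) (sym cut-sorted) (sym grouped) (first-block ∷ ih)
  where
  m∈A = ∈-++⁺ʳ A₁ (here refl)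
  P = concatMap s pre ++ s A₁ ++ s A₂
  P<m : All (_< m) P
  P<m = All-resp-↭ (↭-sym (++⁺ (concatMap-s-↭ pre) (++⁺ (s-↭ A₁) (s-↭ A₂))))
                   (All.++⁺ pre<m (All.++⁺ A₁<m A₂<m))
  P∷m : P ++ [ m ] ≡ concatMap s pre ++ s (A₁ ++ m ∷ A₂)
  P∷m = begin
    P ++ [ m ]
      ≡⟨ solve 4 (λ p a b mm → (p ⊕ a ⊕ b) ⊕ mm ⊜ p ⊕ a ⊕ b ⊕ mm) refl (concatMap s pre) (s A₁) (s A₂) [ m ] ⟩
    concatMap s pre ++ s A₁ ++ s A₂ ++ [ m ] ≡⟨ cong (concatMap s pre ++_) (s-max A₁ A₂ A₁<m A₂<m) ⟨
    concatMap s pre ++ s (A₁ ++ m ∷ A₂)    ∎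
    where open ≡-Reasoning
  sorted-around : concatMap s (pre ++ (A₁ ++ m ∷ A₂) ∷ post) ≡ P ++ m ∷ concatMap s post
  sorted-around = begin
    concatMap s (pre ++ (A₁ ++ m ∷ A₂) ∷ post)                     ≡⟨ concatMap-++ s pre _ ⟩
    concatMap s pre ++ s (A₁ ++ m ∷ A₂) ++ concatMap s post        ≡⟨ sym (++-assoc (concatMap s pre) _ _) ⟩
    (concatMap s pre ++ s (A₁ ++ m ∷ A₂)) ++ concatMap s post      ≡⟨ cong (_++ concatMap s post) P∷m ⟨
    (P ++ [ m ]) ++ concatMap s post                               ≡⟨ ++-assoc P [ m ] _ ⟩
    P ++ m ∷ concatMap s post                                      ∎
    where open ≡-Reasoning
  cut-sorted : B₁ (concatMap s (pre ++ (A₁ ++ m ∷ A₂) ∷ post)) ≡ (P ++ [ m ]) ∷ B₁ (concatMap s post)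
  cut-sorted = trans (cong B₁ sorted-around)
                     (B₁-max P (concatMap s post) P<m (All-resp-↭ (↭-sym (concatMap-s-↭ post)) post<m))
  grouped : dropEmpty (groupGo [] (pre ++ (A₁ ++ m ∷ A₂) ∷ post))
          ≡ (concat pre ++ A₁ ++ m ∷ A₂) ∷ dropEmpty (groupGo [] post)
  grouped = trans (cong dropEmpty (groupGo-at-max [] pre (A₁ ++ m ∷ A₂) post pre<m m∈A post<m))
                  (dropEmpty-∷ (concat pre ++ A₁ ++ m ∷ A₂) (groupGo [] post) (∈-++⁺ʳ (concat pre) m∈A))
  first-block : P ++ [ m ] ↭ concat pre ++ A₁ ++ m ∷ A₂
  first-block = ↭-trans (↭-reflexive P∷m) (++⁺ (concatMap-s-↭ pre) (s-↭ (A₁ ++ m ∷ A₂)))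

blocks-of-sorted-hats : ∀ hs → Unique (concat hs) →
  Pointwise _↭_ (B₁ (concatMap s hs)) (dropEmpty (groupGo [] hs))
blocks-of-sorted-hats = length-ind (λ hs → Unique (concat hs) → Claim hs) go
  where
  Claim : List (List ℕ) → Set
  Claim hs = Pointwise _↭_ (B₁ (concatMap s hs)) (dropEmpty (groupGo [] hs))
  go : ∀ hs → (∀ {hs′} → length hs′ < length hs → Unique (concat hs′) → Claim hs′) →
    Unique (concat hs) → Claim hs
  go hs ih u with concat hs in eq
  ... | [] rewrite concatMap-s-empty hs eq | groupGo-empty hs eq = []
  ... | z ∷ zs with ∈-concat⁻′ hs (subst (maxL (z ∷ zs) ∈_) (sym eq) (maxL-∈ z zs))
  ...   | A , m∈A , A∈hs with ∈-∃++ A∈hs | ∈-∃++ m∈A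
  ...     | pre , post , refl | A₁ , A₂ , refl =
    blocks-at-max pre A₁ m A₂ post (All.++⁻ˡ (concat pre) left) (All.++⁻ʳ (concat pre) left)
      (All.++⁻ˡ A₂ right) (All.++⁻ʳ A₂ right) (ih {post} (proj₂ (parts-shorter pre _ post)) u-post)
    where
    m = maxL (z ∷ zs)
    around = trans (sym (concat-around pre A₁ m A₂ post)) eq
    u′ = subst Unique (sym around) u
    below = strictly-below (concat pre ++ A₁) (A₂ ++ concat post) u′
              (subst (All (_≤ m)) (sym around) (maxL-bounds (z ∷ zs)))
    left = proj₁ below
    right = proj₂ below
    u-post = proj₁ (proj₂ (unique-++ (m ∷ A₂) (proj₁ (proj₂ (unique-++ (concat pre ++ A₁) u′)))))

rlMaxima-B₁ : ∀ L → Unique L → rlMaxima L ≡ 𝓜 (B₁ L)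
rlMaxima-B₁ = maxSplit-ind (λ L → rlMaxima L ≡ 𝓜 (B₁ L)) refl step
  where
  step : ∀ A m B → All (_< m) A → All (_< m) B → rlMaxima A ≡ 𝓜 (B₁ A) → rlMaxima B ≡ 𝓜 (B₁ B) →
    rlMaxima (A ++ m ∷ B) ≡ 𝓜 (B₁ (A ++ m ∷ B))
  step A m B A<m B<m _ ih
    rewrite rlMaxima-max A B A<m B<m | B₁-max A B A<m B<m | maxL-split A [] A<m [] = cong (m ∷_) ih

𝓜-↭ : ∀ {bs cs} → Pointwise _↭_ bs cs → 𝓜 bs ≡ 𝓜 cs
𝓜-↭ [] = refl
𝓜-↭ (b↭c ∷ bs↭cs) = cong₂ _∷_ (maxL-↭ b↭c) (𝓜-↭ bs↭cs)

hats-rlMaxima-↭ : ∀ L → Unique L → concat (hats L) ++ rlMaxima L ↭ L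
hats-rlMaxima-↭ = maxSplit-ind (λ L → concat (hats L) ++ rlMaxima L ↭ L) ↭-refl step
  where
  step : ∀ A m B → All (_< m) A → All (_< m) B →
    concat (hats A) ++ rlMaxima A ↭ A → concat (hats B) ++ rlMaxima B ↭ B →
    concat (hats (A ++ m ∷ B)) ++ rlMaxima (A ++ m ∷ B) ↭ A ++ m ∷ B
  step A m B A<m B<m _ ih rewrite hats-max A B A<m B<m | rlMaxima-max A B A<m B<m = begin
    (A ++ concat (hats B)) ++ m ∷ rlMaxima B ≡⟨ ++-assoc A _ _ ⟩
    A ++ concat (hats B) ++ m ∷ rlMaxima B   ↭⟨ ++⁺ˡ A (shift m (concat (hats B)) (rlMaxima B)) ⟩
    A ++ m ∷ concat (hats B) ++ rlMaxima B   ↭⟨ ++⁺ˡ A (↭-prep m ih) ⟩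
    A ++ m ∷ B                               ∎
    where open PermutationReasoning

unique-hats : ∀ L → Unique L → Unique (concat (hats L))
unique-hats L u = proj₁ (unique-++ (concat (hats L)) (unique-↭ (↭-sym (hats-rlMaxima-↭ L u)) u))

B₁-after-pass : ∀ L → Unique L → Pointwise _↭_ (B₁ (concatMap s (hats L))) (η (B₁ L))
B₁-after-pass L u = blocks-of-sorted-hats (hats L) (unique-hats L u)

InUnion : List ℕ → ℕ → ℕ → Set
InUnion π t x = ∃ λ i → (1 ≤ i) × (i ≤ t) × (x ∈ 𝓜ₗ i π)

InUnion-zero : ∀ {π x} → InUnion π 0 x → ⊥
InUnion-zero (_ , 1≤i , i≤0 , _) = case ≤-trans 1≤i i≤0 of λ ()

InUnion-suc : ∀ π t x → (x ∈ 𝓜ₗ (suc t) π ⊎ InUnion π t x) ⇔ InUnion π (suc t) x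
InUnion-suc π t x = mk⇔ to from
  where
  to : x ∈ 𝓜ₗ (suc t) π ⊎ InUnion π t x → InUnion π (suc t) x
  to (inj₁ x∈) = suc t , s≤s z≤n , ≤-refl , x∈
  to (inj₂ (i , 1≤i , i≤t , x∈)) = i , 1≤i , m≤n⇒m≤1+n i≤t , x∈
  from : InUnion π (suc t) x → x ∈ 𝓜ₗ (suc t) π ⊎ InUnion π t x
  from (i , 1≤i , i≤1+t , x∈) with m≤n⇒m<n∨m≡n i≤1+t
  ... | inj₁ i<1+t = inj₂ (i , 1≤i , ≤-pred i<1+t , x∈)
  ... | inj₂ refl  = inj₁ x∈

∈-↭ : ∀ {x : ℕ} {xs ys} → xs ↭ ys → x ∈ xs ⇔ x ∈ ys
∈-↭ p = mk⇔ (∈-resp-↭ p) (∈-resp-↭ (↭-sym p))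

record Invariant (π : List ℕ) (t : ℕ) : Set where
  field
    L R          : List ℕ
    split        : sIter t π ≡ L ++ R
    R-increasing : AllPairs _<_ R
    R-union      : ∀ x → x ∈ R ⇔ InUnion π t x
    L-blocks     : Pointwise _↭_ (B₁ L) (𝓑 (suc t) π)

  module _ (u : Unique π) where
    unique-split : Unique (L ++ R)
    unique-split = subst Unique split (unique-↭ (↭-sym (sIter-↭ t π)) u)

    L-unique : Unique L
    L-unique = proj₁ (unique-++ L unique-split)

    L-rlMaxima : rlMaxima L ≡ 𝓜ₗ (suc t) π
    L-rlMaxima = trans (rlMaxima-B₁ L L-unique) (𝓜-↭ L-blocks)

-- Induction on t: one pass over L ++ R (one-pass lemma) yields the next L and R, the new
-- R collecting the right-to-left maxima of L, which form 𝓜ₜ₊₁(π); the new 𝓑₁(L) is η of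
-- the old one (block lemma), hence 𝓑ₜ₊₂(π) up to rearrangement (η-↭).
invariant : ∀ π → Unique π → ∀ t → Invariant π t
invariant π u zero = record
  { L = π ; R = [] ; split = sym (++-identityʳ π) ; R-increasing = []
  ; R-union = λ x → mk⇔ (λ ()) (⊥-elim ∘ InUnion-zero)
  ; L-blocks = Pointwise.refl ↭-refl }
invariant π u (suc t) = record
  { L = concatMap s (hats L) ; R = W
  ; split = trans (cong s split) s-split
  ; R-increasing = increasing
  ; R-union = λ x →
      ⇔-trans (∈-↭ (↭-trans entries (++⁺ʳ R (↭-reflexive (L-rlMaxima u)))))
        (⇔-trans ++-∈⇔ (⇔-trans (⇔-refl ⊎-⇔ R-union x) (InUnion-suc π t x)))
  ; L-blocks = Pointwise.transitive ↭-trans (B₁-after-pass L (L-unique u)) (η-↭ L-blocks) }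
  where
  open Invariant (invariant π u t)
  open OnePass (one-pass L (L-unique u) R R-increasing (proj₂ (proj₂ (unique-++ L (unique-split u)))))

lemma2p7 : (π : List ℕ) → Unique π → All (0 <_) π →
    (t : ℕ) → 1 ≤ t →
    Σ (List ℕ) λ L → Σ (List ℕ) λ R →
      (sIter t π ≡ L ++ R)
      × Linked _<_ R
      × (∀ x → (x ∈ R) ⇔ (∃ λ i → (1 ≤ i) × (i ≤ t) × (x ∈ 𝓜ₗ i π)))
      × (∀ x → (x ∈ rlMaxima L) ⇔ (x ∈ 𝓜ₗ (suc t) π))
lemma2p7 π u _ t _ =
  L , R , split , AllPairs⇒Linked R-increasing , R-union , λ x → ∈-↭ (↭-reflexive (L-rlMaxima u))
  where open Invariant (invariant π u t)
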